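{- Let $m$ and $n$ be positive integers with $n\leq m$. Then $\gamma_{\{R2\}}(K_n\square K_m)=\min\{m,2n\}$.
   Context: A Roman $\{2\}$-dominating function on a graph $G=(V,E)$ is a function $f:V\to\{0,1,2\}$ such that for every vertex $v$ with $f(v)=0$, $\sum_{u\in N(v)}f(u)\geq 2$. Its weight is $\sum_{v\in V}f(v)$, and $\gamma_{\{R2\}}(G)$ is the minimum weight of such a function. $K_n$ is the complete graph on $n$ vertices. The Cartesian product $G\square H$ has vertex set $V(G)\times V(H)$, with $(u,v)$ adjacent to $(x,y)$ iff either $u=x$ and $vy\in E(H)$, or $v=y$ and $ux\in E(G)$. -}

module Defs where

open import Data.Nat using (ℕ; _+_; _≤_)
open import Data.Fin using (Fin)
open import Data.Product using (_×_; _,_; Σ)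
import Data.Product.Properties
open import Data.Sum using (_⊎_)
open import Data.Nat.ListAction using (sum)
open import Data.List using (List; map; allFin; cartesianProduct; filter)
open import Data.List.Membership.Propositional using (_∈_)
open import Data.List.Membership.Propositional.Properties
  using (∈-allFin; ∈-cartesianProduct⁺)
open import Data.List.Relation.Unary.Unique.Propositional using (Unique)
open import Data.List.Relation.Unary.Unique.Propositional.Properties
  using (allFin⁺; cartesianProduct⁺)
open import Relation.Binary.PropositionalEquality using (_≡_; _≢_)
open import Relation.Nullary using (¬_; Dec; yes; no)
open import Relation.Nullary.Decidable using (_×-dec_; _⊎-dec_; ¬?)
open import Data.Fin.Properties using () renaming (_≟_ to _≟ᶠ_)

record Graph : Set₁ where
  field
    V        : Set
    vertices : List V
    unique   : Unique vertices
    complete : ∀ v → v ∈ vertices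
    Adj      : V → V → Set
    adj-sym  : ∀ {u v} → Adj u v → Adj v u
    irrefl   : ∀ {v} → ¬ Adj v v
    adj?     : ∀ u v → Dec (Adj u v)
    eq?      : ∀ (u v : V) → Dec (u ≡ v)
open Graph public

K : ℕ → Graph
K n = record
  { V = Fin n
  ; vertices = allFin n
  ; unique = allFin⁺ n
  ; complete = ∈-allFin
  ; Adj = λ u v → u ≢ v
  ; adj-sym = λ u≢v v≡u → u≢v (Relation.Binary.PropositionalEquality.sym v≡u)
  ; irrefl = λ v≢v → v≢v Relation.Binary.PropositionalEquality.refl
  ; adj? = λ u v → ¬? (u ≟ᶠ v)
  ; eq? = _≟ᶠ_
  }

_□_ : Graph → Graph → Graph
G □ H = record
  { V = V G × V H
  ; vertices = cartesianProduct (vertices G) (vertices H)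
  ; unique = cartesianProduct⁺ (unique G) (unique H)
  ; complete = λ { (u , v) → ∈-cartesianProduct⁺ (complete G u) (complete H v) }
  ; Adj = λ { (u , v) (x , y) → (u ≡ x × Adj H v y) ⊎ (v ≡ y × Adj G u x) }
  ; adj-sym = λ { (Data.Sum.inj₁ (p , a)) → Data.Sum.inj₁ (Relation.Binary.PropositionalEquality.sym p , adj-sym H a)
                ; (Data.Sum.inj₂ (p , a)) → Data.Sum.inj₂ (Relation.Binary.PropositionalEquality.sym p , adj-sym G a) }
  ; irrefl = λ { (Data.Sum.inj₁ (_ , a)) → irrefl H a ; (Data.Sum.inj₂ (_ , a)) → irrefl G a }
  ; adj? = λ { (u , v) (x , y) → (eq? G u x ×-dec adj? H v y) ⊎-dec (eq? H v y ×-dec adj? G u x) }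
  ; eq? = λ { (u , v) (x , y) → Data.Product.Properties.≡-dec (eq? G) (eq? H) (u , v) (x , y) }
  }

Label : Set
Label = Fin 3

val : Label → ℕ
val l = Data.Fin.toℕ l

weight : (G : Graph) → (V G → Label) → ℕ
weight G f = sum (map (λ v → val (f v)) (vertices G))

nbhdSum : (G : Graph) → (V G → Label) → V G → ℕ
nbhdSum G f v = sum (map (λ u → val (f u)) (filter (λ u → adj? G v u) (vertices G)))

IsR2DF : (G : Graph) → (V G → Label) → Set
IsR2DF G f = ∀ v → f v ≡ Data.Fin.zero → 2 ≤ nbhdSum G f v

IsR2DominationNumber : Graph → ℕ → Set
IsR2DominationNumber G k =
  Σ (V G → Label) (λ f → IsR2DF G f × weight G f ≡ k)
  × (∀ (f : V G → Label) → IsR2DF G f → k ≤ weight G f)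

module Submission where

-- Lower bound: if a Roman {2}-dominating function f of Kₙ □ Kₘ had weight below both m and 2n,
-- some column would carry total weight 0 and some row total weight at most 1. The vertex where
-- they cross is labelled 0, and all its neighbours lie in that row or that column, so its
-- neighbourhood sum is at most 1 — a contradiction.
-- Upper bounds: labelling one whole column by 2 has weight 2n; labelling by 1 exactly the
-- vertices (j mod n, j) has weight m, and every other vertex (i, j) sees the 1 in its column
-- and the 1 at (i, i) in its row.

open import Defs
open import Data.Nat using (ℕ; _≤_; _*_; _⊓_; NonZero)
open import Data.Nat.Base using (suc; _+_; _<_; _%_; z≤n; >-nonZero⁻¹)
open import Data.Nat.Properties hiding (_≟_)
open import Data.Nat.DivMod using (m%n<n; m<n⇒m%n≡m)
open import Data.Nat.ListAction using (sum)
open import Data.Nat.ListAction.Properties using (sum-++)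
open import Data.List using (List; []; _∷_; map; allFin; cartesianProduct; filter; length; _++_)
open import Data.List.Properties using (map-++; map-∘; map-cong; map-tabulate; length-tabulate)
open import Data.List.Membership.Propositional using (_∈_)
open import Data.List.Membership.Propositional.Properties using (∈-filter⁺; ∈-allFin)
open import Data.List.Relation.Unary.Any using (here; there)
open import Data.Fin.Base as Fin using (Fin; toℕ; fromℕ<; inject≤)
open import Data.Fin.Properties using (toℕ-injective; toℕ-fromℕ<; toℕ-inject≤; toℕ<n; _≟_)
open import Data.Product using (_×_; _,_; ∃; proj₁; proj₂)
open import Data.Sum using (inj₁; inj₂)
open import Data.Bool using (if_then_else_)
open import Relation.Nullary using (yes; no; does; contradiction)
open import Relation.Unary using (Decidable)
open import Relation.Binary.PropositionalEquality
open import Algebra.Properties.CommutativeSemigroup +-commutativeSemigroup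
  using () renaming (interchange to +-interchange)

private
  variable
    A B : Set

∑ : List A → (A → ℕ) → ℕ
∑ xs h = sum (map h xs)

∑-cong : ∀ (xs : List A) {h k : A → ℕ} → (∀ x → h x ≡ k x) → ∑ xs h ≡ ∑ xs k
∑-cong xs h≗k = cong sum (map-cong h≗k xs)

∑-const : ∀ (xs : List A) c → ∑ xs (λ _ → c) ≡ length xs * c
∑-const []       c = refl
∑-const (x ∷ xs) c = cong (c +_) (∑-const xs c)

∑-zero : ∀ (xs : List A) → ∑ xs (λ _ → 0) ≡ 0
∑-zero xs = trans (∑-const xs 0) (*-zeroʳ (length xs))

∑-distrib-+ : ∀ (xs : List A) (h k : A → ℕ) → ∑ xs (λ x → h x + k x) ≡ ∑ xs h + ∑ xs k
∑-distrib-+ []       h k = refl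
∑-distrib-+ (x ∷ xs) h k =
  trans (cong (h x + k x +_) (∑-distrib-+ xs h k)) (+-interchange (h x) (k x) (∑ xs h) (∑ xs k))

∑-cartesianProduct : ∀ (xs : List A) (ys : List B) h →
  ∑ (cartesianProduct xs ys) h ≡ ∑ xs (λ x → ∑ ys (λ y → h (x , y)))
∑-cartesianProduct []       ys h = refl
∑-cartesianProduct (x ∷ xs) ys h = begin
  sum (map h (map (x ,_) ys ++ cartesianProduct xs ys))
    ≡⟨ cong sum (map-++ h (map (x ,_) ys) (cartesianProduct xs ys)) ⟩
  sum (map h (map (x ,_) ys) ++ map h (cartesianProduct xs ys))
    ≡⟨ sum-++ (map h (map (x ,_) ys)) _ ⟩
  ∑ (map (x ,_) ys) h + ∑ (cartesianProduct xs ys) h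
    ≡⟨ cong₂ _+_ (cong sum (sym (map-∘ ys))) (∑-cartesianProduct xs ys h) ⟩
  ∑ ys (λ y → h (x , y)) + ∑ xs (λ x → ∑ ys (λ y → h (x , y))) ∎
  where open ≡-Reasoning

∑-comm : ∀ (xs : List A) (ys : List B) (h : A → B → ℕ) →
  ∑ xs (λ x → ∑ ys (h x)) ≡ ∑ ys (λ y → ∑ xs (λ x → h x y))
∑-comm []       ys h = sym (∑-zero ys)
∑-comm (x ∷ xs) ys h = trans (cong (∑ ys (h x) +_) (∑-comm xs ys h))
  (sym (∑-distrib-+ ys (h x) (λ y → ∑ xs (λ x → h x y))))

∈⇒≤∑ : ∀ {x : A} {xs} (h : A → ℕ) → x ∈ xs → h x ≤ ∑ xs h
∈⇒≤∑ h (here refl) = m≤m+n _ _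
∈⇒≤∑ {xs = y ∷ xs} h (there x∈xs) = ≤-trans (∈⇒≤∑ h x∈xs) (m≤n+m _ (h y))

∈∧∈⇒+≤∑ : ∀ {x y : A} {xs} (h : A → ℕ) → x ≢ y → x ∈ xs → y ∈ xs → h x + h y ≤ ∑ xs h
∈∧∈⇒+≤∑ h x≢y (here refl) (here refl)   = contradiction refl x≢y
∈∧∈⇒+≤∑ h x≢y (here refl) (there y∈xs)  = +-monoʳ-≤ _ (∈⇒≤∑ h y∈xs)
∈∧∈⇒+≤∑ {x = x} {y} {xs = .y ∷ xs} h x≢y (there x∈xs) (here refl) =
  subst (_≤ h y + ∑ xs h) (+-comm (h y) (h x)) (+-monoʳ-≤ (h y) (∈⇒≤∑ h x∈xs))
∈∧∈⇒+≤∑ {xs = z ∷ xs} h x≢y (there x∈xs) (there y∈xs) =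
  ≤-trans (∈∧∈⇒+≤∑ h x≢y x∈xs y∈xs) (m≤n+m _ (h z))

∑-filter-≤ : ∀ {P : A → Set} (P? : Decidable P) (xs : List A) (h k : A → ℕ) →
  (∀ x → P x → h x ≤ k x) → ∑ (filter P? xs) h ≤ ∑ xs k
∑-filter-≤ P? []       h k h≤k = z≤n
∑-filter-≤ P? (x ∷ xs) h k h≤k with P? x
... | yes Px = +-mono-≤ (h≤k x Px) (∑-filter-≤ P? xs h k h≤k)
... | no  _  = ≤-trans (∑-filter-≤ P? xs h k h≤k) (m≤n+m _ (k x))

∑<⇒∃< : ∀ (xs : List A) (h : A → ℕ) t → ∑ xs h < t * length xs → ∃ λ x → h x < t
∑<⇒∃< []       h t ∑<0 = contradiction (subst (0 <_) (*-zeroʳ t) ∑<0) (n≮n 0)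
∑<⇒∃< (x ∷ xs) h t ∑< with h x <? t
... | yes hx<t = x , hx<t
... | no  hx≮t = ∑<⇒∃< xs h t (+-cancelˡ-< t _ _ (begin-strict
  t + ∑ xs h   ≤⟨ +-monoˡ-≤ (∑ xs h) (≮⇒≥ hx≮t) ⟩
  h x + ∑ xs h <⟨ ∑< ⟩
  t * suc (length xs) ≡⟨ *-suc t (length xs) ⟩
  t + t * length xs ∎))
  where open ≤-Reasoning

length-allFin : ∀ n → length (allFin n) ≡ n
length-allFin n = length-tabulate {n = n} (λ i → i)

∑-allFin-suc : ∀ n (h : Fin (suc n) → ℕ) → ∑ (allFin (suc n)) h ≡ h Fin.zero + ∑ (allFin n) (λ i → h (Fin.suc i))
∑-allFin-suc n h = cong (h Fin.zero +_) (cong sum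
  (trans (map-tabulate Fin.suc h) (sym (map-tabulate (λ i → i) (λ i → h (Fin.suc i))))))

only : ∀ {n} → Fin n → (Fin n → ℕ) → Fin n → ℕ
only r h i = if does (i ≟ r) then h i else 0

only-self : ∀ {n} (r : Fin n) h → only r h r ≡ h r
only-self r h with r ≟ r
... | yes _   = refl
... | no  r≢r = contradiction refl r≢r

∑-only : ∀ n (r : Fin n) (h : Fin n → ℕ) → ∑ (allFin n) (only r h) ≡ h r
∑-only (suc n) Fin.zero h = begin
  ∑ (allFin (suc n)) (only Fin.zero h) ≡⟨ ∑-allFin-suc n (only Fin.zero h) ⟩
  h Fin.zero + ∑ (allFin n) (λ _ → 0)   ≡⟨ cong (h Fin.zero +_) (∑-zero (allFin n)) ⟩
  h Fin.zero + 0                        ≡⟨ +-identityʳ _ ⟩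
  h Fin.zero                            ∎
  where open ≡-Reasoning
∑-only (suc n) (Fin.suc r) h = begin
  ∑ (allFin (suc n)) (only (Fin.suc r) h)  ≡⟨ ∑-allFin-suc n (only (Fin.suc r) h) ⟩
  ∑ (allFin n) (λ i → only (Fin.suc r) h (Fin.suc i)) ≡⟨ ∑-cong (allFin n) only-suc ⟩
  ∑ (allFin n) (only r (λ i → h (Fin.suc i)))          ≡⟨ ∑-only n r (λ i → h (Fin.suc i)) ⟩
  h (Fin.suc r)                                        ∎
  where
  open ≡-Reasoning
  only-suc : ∀ i → only (Fin.suc r) h (Fin.suc i) ≡ only r (λ i → h (Fin.suc i)) i
  only-suc i with i ≟ r
  ... | yes refl = refl
  ... | no  _    = refl

neighbour⇒≤nbhdSum : ∀ (G : Graph) f {v u} → Adj G v u → val (f u) ≤ nbhdSum G f v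
neighbour⇒≤nbhdSum G f {v} {u} v~u =
  ∈⇒≤∑ (λ w → val (f w)) (∈-filter⁺ (adj? G v) (complete G u) v~u)

twoNeighbours⇒≤nbhdSum : ∀ (G : Graph) f {v u w} → u ≢ w → Adj G v u → Adj G v w →
  val (f u) + val (f w) ≤ nbhdSum G f v
twoNeighbours⇒≤nbhdSum G f {v} {u} {w} u≢w v~u v~w = ∈∧∈⇒+≤∑ (λ x → val (f x)) u≢w
  (∈-filter⁺ (adj? G v) (complete G u) v~u) (∈-filter⁺ (adj? G v) (complete G w) v~w)

module Grid {n m : ℕ} (f : Fin n × Fin m → Label) where

  entry : Fin n → Fin m → ℕ
  entry i j = val (f (i , j))

  rowSum : Fin n → ℕ
  rowSum i = ∑ (allFin m) (entry i)

  colSum : Fin m → ℕ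
  colSum j = ∑ (allFin n) (λ i → entry i j)

  weight≡∑rowSum : weight (K n □ K m) f ≡ ∑ (allFin n) rowSum
  weight≡∑rowSum = ∑-cartesianProduct (allFin n) (allFin m) (λ v → val (f v))

  weight≡∑colSum : weight (K n □ K m) f ≡ ∑ (allFin m) colSum
  weight≡∑colSum = trans weight≡∑rowSum (∑-comm (allFin n) (allFin m) entry)

  nbhdSum≤rowSum+colSum : ∀ r c → nbhdSum (K n □ K m) f (r , c) ≤ rowSum r + colSum c
  nbhdSum≤rowSum+colSum r c = ≤-trans
    (∑-filter-≤ (adj? (K n □ K m) (r , c)) (vertices (K n □ K m)) (λ v → val (f v)) cross f≤cross)
    (≤-reflexive ∑cross)
    where
    cross : Fin n × Fin m → ℕ
    cross (i , j) = only r (λ i → entry i j) i + only c (entry i) j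

    f≤cross : ∀ v → Adj (K n □ K m) (r , c) v → val (f v) ≤ cross v
    f≤cross (i , j) (inj₁ (refl , _)) = ≤-trans (≤-reflexive (sym (only-self r (λ i → entry i j)))) (m≤m+n _ _)
    f≤cross (i , j) (inj₂ (refl , _)) = ≤-trans (≤-reflexive (sym (only-self c (entry i)))) (m≤n+m _ _)

    ∑cross : ∑ (vertices (K n □ K m)) cross ≡ rowSum r + colSum c
    ∑cross = begin
      ∑ (vertices (K n □ K m)) cross
        ≡⟨ ∑-cartesianProduct (allFin n) (allFin m) cross ⟩
      ∑ (allFin n) (λ i → ∑ (allFin m) (λ j → only r (λ i → entry i j) i + only c (entry i) j))
        ≡⟨ ∑-cong (allFin n) (λ i → ∑-distrib-+ (allFin m) _ _) ⟩
      ∑ (allFin n) (λ i → ∑ (allFin m) (λ j → only r (λ i → entry i j) i) + ∑ (allFin m) (only c (entry i)))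
        ≡⟨ ∑-distrib-+ (allFin n) _ _ ⟩
      ∑ (allFin n) (λ i → ∑ (allFin m) (λ j → only r (λ i → entry i j) i)) + ∑ (allFin n) (λ i → ∑ (allFin m) (only c (entry i)))
        ≡⟨ cong₂ _+_ (∑-comm (allFin n) (allFin m) (λ i j → only r (λ i → entry i j) i))
                     (∑-cong (allFin n) (λ i → ∑-only m c (entry i))) ⟩
      ∑ (allFin m) (λ j → ∑ (allFin n) (only r (λ i → entry i j))) + colSum c
        ≡⟨ cong (_+ colSum c) (∑-cong (allFin m) (λ j → ∑-only n r (λ i → entry i j))) ⟩
      rowSum r + colSum c ∎
      where open ≡-Reasoning

R2DF-weight≥ : ∀ n m (f : Fin n × Fin m → Label) → IsR2DF (K n □ K m) f →
  m ⊓ (2 * n) ≤ weight (K n □ K m) f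
R2DF-weight≥ n m f isR2DF with m ⊓ (2 * n) ≤? weight (K n □ K m) f
... | yes ok = ok
... | no  w≱ = contradiction (isR2DF (r , c) f[r,c]≡0) (<⇒≱ nbhd<2)
  where
  open Grid f
  w< : weight (K n □ K m) f < m ⊓ (2 * n)
  w< = ≰⇒> w≱

  emptyColumn : ∃ λ c → colSum c < 1
  emptyColumn = ∑<⇒∃< (allFin m) colSum 1 (subst₂ _<_ weight≡∑colSum
    (sym (trans (*-identityˡ _) (length-allFin m))) (<-≤-trans w< (m⊓n≤m m (2 * n))))

  lightRow : ∃ λ r → rowSum r < 2
  lightRow = ∑<⇒∃< (allFin n) rowSum 2 (subst₂ _<_ weight≡∑rowSum
    (cong (2 *_) (sym (length-allFin n))) (<-≤-trans w< (m⊓n≤n m (2 * n))))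

  c : Fin m
  c = proj₁ emptyColumn

  r : Fin n
  r = proj₁ lightRow

  colSum≡0 : colSum c ≡ 0
  colSum≡0 = n<1⇒n≡0 (proj₂ emptyColumn)

  f[r,c]≡0 : f (r , c) ≡ Fin.zero
  f[r,c]≡0 = toℕ-injective (n≤0⇒n≡0 (subst (entry r c ≤_) colSum≡0
    (∈⇒≤∑ (λ i → entry i c) (∈-allFin r))))

  nbhd<2 : nbhdSum (K n □ K m) f (r , c) < 2
  nbhd<2 = ≤-<-trans (nbhdSum≤rowSum+colSum r c)
    (subst (_< 2) (sym (trans (cong (rowSum r +_) colSum≡0) (+-identityʳ _))) (proj₂ lightRow))

module ColumnOfTwos {n m : ℕ} (c : Fin m) where

  labelling : Fin n × Fin m → Label
  labelling (i , j) = if does (j ≟ c) then Fin.suc (Fin.suc Fin.zero) else Fin.zero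

  val-labelling : ∀ i j → val (labelling (i , j)) ≡ only c (λ _ → 2) j
  val-labelling i j with j ≟ c
  ... | yes _ = refl
  ... | no  _ = refl

  weight-labelling : weight (K n □ K m) labelling ≡ 2 * n
  weight-labelling = begin
    weight (K n □ K m) labelling    ≡⟨ Grid.weight≡∑rowSum labelling ⟩
    ∑ (allFin n) (Grid.rowSum labelling)
      ≡⟨ ∑-cong (allFin n) (λ i → trans (∑-cong (allFin m) (val-labelling i)) (∑-only m c (λ _ → 2))) ⟩
    ∑ (allFin n) (λ _ → 2)          ≡⟨ ∑-const (allFin n) 2 ⟩
    length (allFin n) * 2           ≡⟨ cong (_* 2) (length-allFin n) ⟩
    n * 2                           ≡⟨ *-comm n 2 ⟩
    2 * n                           ∎
    where open ≡-Reasoning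

  isR2DF : IsR2DF (K n □ K m) labelling
  isR2DF (i , j) f≡0 with j ≟ c | f≡0
  ... | yes _   | ()
  ... | no  j≢c | _  = subst (_≤ nbhdSum (K n □ K m) labelling (i , j))
    (trans (val-labelling i c) (only-self c (λ _ → 2)))
    (neighbour⇒≤nbhdSum (K n □ K m) labelling (inj₁ (refl , j≢c)))

module OnePerColumn {n m : ℕ} (ρ : Fin m → Fin n) where

  labelling : Fin n × Fin m → Label
  labelling (i , j) = if does (i ≟ ρ j) then Fin.suc Fin.zero else Fin.zero

  val-labelling : ∀ i j → val (labelling (i , j)) ≡ only (ρ j) (λ _ → 1) i
  val-labelling i j with i ≟ ρ j
  ... | yes _ = refl
  ... | no  _ = refl

  weight-labelling : weight (K n □ K m) labelling ≡ m
  weight-labelling = begin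
    weight (K n □ K m) labelling    ≡⟨ Grid.weight≡∑colSum labelling ⟩
    ∑ (allFin m) (Grid.colSum labelling)
      ≡⟨ ∑-cong (allFin m) (λ j → trans (∑-cong (allFin n) (λ i → val-labelling i j)) (∑-only n (ρ j) (λ _ → 1))) ⟩
    ∑ (allFin m) (λ _ → 1)          ≡⟨ ∑-const (allFin m) 1 ⟩
    length (allFin m) * 1           ≡⟨ *-identityʳ _ ⟩
    length (allFin m)               ≡⟨ length-allFin m ⟩
    m                               ∎
    where open ≡-Reasoning

  isR2DF : (ι : Fin n → Fin m) → (∀ i → ρ (ι i) ≡ i) → IsR2DF (K n □ K m) labelling
  isR2DF ι ρ∘ι≗id (i , j) f≡0 with i ≟ ρ j | f≡0
  ... | yes _    | ()
  ... | no  i≢ρj | _  = subst (_≤ nbhdSum (K n □ K m) labelling (i , j)) (cong₂ _+_ one-in-column one-in-row)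
    (twoNeighbours⇒≤nbhdSum (K n □ K m) labelling (λ eq → i≢ρj (sym (cong proj₁ eq)))
      (inj₂ (refl , i≢ρj)) (inj₁ (refl , λ j≡ιi → i≢ρj (trans (sym (ρ∘ι≗id i)) (cong ρ (sym j≡ιi))))))
    where
    one-in-column : val (labelling (ρ j , j)) ≡ 1
    one-in-column = trans (val-labelling (ρ j) j) (only-self (ρ j) (λ _ → 1))
    one-in-row : val (labelling (i , ι i)) ≡ 1
    one-in-row = trans (val-labelling i (ι i))
      (subst (λ r → only r (λ _ → 1) i ≡ 1) (sym (ρ∘ι≗id i)) (only-self i (λ _ → 1)))

mod : ∀ {n m} .{{_ : NonZero n}} → Fin m → Fin n
mod {n} j = fromℕ< (m%n<n (toℕ j) n)

mod-inject≤ : ∀ {n m} .{{_ : NonZero n}} (n≤m : n ≤ m) (i : Fin n) → mod (inject≤ i n≤m) ≡ i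
mod-inject≤ {n} n≤m i = toℕ-injective (begin
  toℕ (mod (inject≤ i n≤m)) ≡⟨ toℕ-fromℕ< _ ⟩
  toℕ (inject≤ i n≤m) % n   ≡⟨ cong (_% n) (toℕ-inject≤ i n≤m) ⟩
  toℕ i % n                 ≡⟨ m<n⇒m%n≡m (toℕ<n i) ⟩
  toℕ i                     ∎)
  where open ≡-Reasoning

theorem3p4 : ∀ (m n : ℕ) → .{{NonZero m}} → .{{NonZero n}} → n ≤ m →
    IsR2DominationNumber (K n □ K m) (m ⊓ (2 * n))
theorem3p4 m n n≤m with m ≤? 2 * n
... | yes m≤2n =
  ( OnePerColumn.labelling mod
  , OnePerColumn.isR2DF mod (λ i → inject≤ i n≤m) (mod-inject≤ n≤m)
  , trans (OnePerColumn.weight-labelling mod) (sym (m≤n⇒m⊓n≡m m≤2n)) )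
  , R2DF-weight≥ n m
... | no  m≰2n =
  ( ColumnOfTwos.labelling {n} c
  , ColumnOfTwos.isR2DF c
  , trans (ColumnOfTwos.weight-labelling {n} c) (sym (m≥n⇒m⊓n≡n (<⇒≤ (≰⇒> m≰2n)))) )
  , R2DF-weight≥ n m
  where
  c : Fin m
  c = fromℕ< (>-nonZero⁻¹ m)
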